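{- Let $L$ be a finite algebra in $\mathcal V_2$ such that $\mathbf 1$ is join irreducible in $L$. Let $a,c\in L$ with $c\ll a$. Then there exist an extension $L'$ of $L$ in $\mathcal V_2$ and an element $b\in L'$ such that $c\ll b\ll a$. If moreover $a\ne\mathbf 0$, one can require $b\ne\mathbf 0$.
   Context: A co-Heyting algebra is a bounded distributive lattice $(L,\mathbf{0},\mathbf{1},\vee,\wedge)$ with a binary operation $-$ such that $a-b$ is the least $c\in L$ with $a\le b\vee c$; extensions are in the language $\{\mathbf 0,\mathbf 1,\vee,\wedge,-\}$. For $a,b$ write $b\ll a$ iff $a-b=a$ and $b\le a$. An element $a$ is join irreducible if it is not the join of any finite subset not containing $a$. $\mathcal V_2$ is the variety of co-Heyting algebras satisfying $(\mathbf 1-x)\wedge(\mathbf 1-(\mathbf 1-x))=\mathbf 0$. -}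

module Defs where

open import Level using (0ℓ)
open import Data.Product using (Σ; _×_; _,_; ∃; ∃-syntax)
open import Data.List using (List; foldr)
open import Data.List.Membership.Propositional using (_∈_)
open import Relation.Binary.PropositionalEquality using (_≡_)
open import Algebra.Core using (Op₂)
import Algebra.Definitions as AD
import Algebra.Lattice.Structures as LS
open import Function.Definitions using (Injective)

record CoHeyting : Set₁ where
  infixr 6 _∨_
  infixr 7 _∧_
  infixl 8 _-_
  field
    Carrier : Set
    𝟎 𝟏 : Carrier
    _∨_ _∧_ _-_ : Op₂ Carrier
    isDistributiveLattice : LS.IsDistributiveLattice (_≡_ {A = Carrier}) _∨_ _∧_
    ∨-identity : AD.Identity (_≡_ {A = Carrier}) 𝟎 _∨_
    ∧-identity : AD.Identity (_≡_ {A = Carrier}) 𝟏 _∧_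

  _≤_ : Carrier → Carrier → Set
  a ≤ b = a ∧ b ≡ a

  field
    minus-cover : ∀ a b → a ≤ (b ∨ (a - b))
    minus-least : ∀ a b c → a ≤ (b ∨ c) → (a - b) ≤ c

  _≪_ : Carrier → Carrier → Set
  b ≪ a = ((a - b) ≡ a) × (b ≤ a)

  ⋁ : List Carrier → Carrier
  ⋁ = foldr _∨_ 𝟎

  JoinIrreducible : Carrier → Set
  JoinIrreducible a = ∀ (xs : List Carrier) → a ≡ ⋁ xs → a ∈ xs

open CoHeyting

InV₂ : CoHeyting → Set
InV₂ L = ∀ x → _∧_ L (_-_ L (𝟏 L) x) (_-_ L (𝟏 L) (_-_ L (𝟏 L) x)) ≡ 𝟎 L

Finite : CoHeyting → Set
Finite L = Σ (List (Carrier L)) λ xs → ∀ x → x ∈ xs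

-- an embedding of co-Heyting algebras (injective homomorphism in the
-- language {0,1,∨,∧,-}); L' with such an f is an extension of L
record Embedding (L L' : CoHeyting) : Set where
  field
    f : Carrier L → Carrier L'
    injective : Injective _≡_ _≡_ f
    pres-𝟎 : f (𝟎 L) ≡ 𝟎 L'
    pres-𝟏 : f (𝟏 L) ≡ 𝟏 L'
    pres-∨ : ∀ x y → f (_∨_ L x y) ≡ _∨_ L' (f x) (f y)
    pres-∧ : ∀ x y → f (_∧_ L x y) ≡ _∧_ L' (f x) (f y)
    pres-- : ∀ x y → f (_-_ L x y) ≡ _-_ L' (f x) (f y)

-- L embeds diagonally, z ↦ (z , z), into the co-Heyting algebra of pairs x ≤ y of L with
-- y ≤ x ∨ a and y ∧ c ≤ x, and b = (c , a) lies strictly between: c ≪ b ≪ a reduces to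
-- a - c = a, and b ≠ 𝟎 as soon as a ≠ 𝟎. Join irreducibility of 𝟏 means every z is 𝟏 or has
-- 𝟏 - z = 𝟏; this dichotomy passes from the lower components to the pairs, and it forces the
-- V₂ identity.
module Submission where

open import Level using (0ℓ)
open import Data.Product using (Σ; _×_; _,_; proj₁; proj₂)
open import Data.Sum using (_⊎_; inj₁; inj₂)
open import Data.List using (_∷_; [])
open import Data.List.Relation.Unary.Any using (here; there)
open import Relation.Binary.PropositionalEquality
open import Relation.Nullary using (¬_)
open import Algebra.Lattice.Bundles using (Lattice)
open import Algebra.Lattice.Structures using (IsDistributiveLattice)
import Algebra.Lattice.Properties.Lattice as LatticeProperties
import Relation.Binary.Lattice as OrderLattice
import Relation.Binary.Lattice.Properties.JoinSemilattice as JoinProperties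
import Relation.Binary.Lattice.Properties.MeetSemilattice as MeetProperties
open import Axiom.UniquenessOfIdentityProofs.WithK using (uip)
open import Defs

TopDichotomy : CoHeyting → Set
TopDichotomy M = ∀ z → z ≡ 𝟏 ⊎ 𝟏 - z ≡ 𝟏
  where open CoHeyting M

module Properties (L : CoHeyting) where
  open CoHeyting L
  open IsDistributiveLattice isDistributiveLattice public
    using (isLattice; ∨-comm; ∨-assoc; ∧-comm; ∧-assoc; ∨-absorbs-∧; ∧-absorbs-∨;
           ∨-distribˡ-∧; ∨-distribʳ-∧; ∧-distribˡ-∨; ∧-distribʳ-∨)

  private
    lattice : Lattice 0ℓ 0ℓ
    lattice = record { isLattice = isLattice }

  open LatticeProperties lattice public using (∧-idem; ∨-idem)

  -- The library orders a lattice by x ≡ x ∧ y, the converse equation of _≤_.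
  private
    module O = OrderLattice.Lattice (LatticeProperties.∨-∧-orderTheoreticLattice lattice)

  ≤-refl : ∀ {x} → x ≤ x
  ≤-refl = sym O.refl

  ≤-trans : ∀ {x y z} → x ≤ y → y ≤ z → x ≤ z
  ≤-trans p q = sym (O.trans (sym p) (sym q))

  ≤-antisym : ∀ {x y} → x ≤ y → y ≤ x → x ≡ y
  ≤-antisym p q = O.antisym (sym p) (sym q)

  x∧y≤x : ∀ x y → (x ∧ y) ≤ x
  x∧y≤x x y = sym (O.x∧y≤x x y)

  x∧y≤y : ∀ x y → (x ∧ y) ≤ y
  x∧y≤y x y = sym (O.x∧y≤y x y)

  ∧-greatest : ∀ {x y z} → z ≤ x → z ≤ y → z ≤ (x ∧ y)
  ∧-greatest p q = sym (O.∧-greatest (sym p) (sym q))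

  x≤x∨y : ∀ x y → x ≤ (x ∨ y)
  x≤x∨y x y = sym (O.x≤x∨y x y)

  y≤x∨y : ∀ x y → y ≤ (x ∨ y)
  y≤x∨y x y = sym (O.y≤x∨y x y)

  ∨-least : ∀ {x y z} → x ≤ z → y ≤ z → (x ∨ y) ≤ z
  ∨-least p q = sym (O.∨-least (sym p) (sym q))

  ∨-monotonic : ∀ {x y u v} → x ≤ y → u ≤ v → (x ∨ u) ≤ (y ∨ v)
  ∨-monotonic p q = sym (JoinProperties.∨-monotonic O.joinSemilattice (sym p) (sym q))

  ∧-monotonic : ∀ {x y u v} → x ≤ y → u ≤ v → (x ∧ u) ≤ (y ∧ v)
  ∧-monotonic p q = sym (MeetProperties.∧-monotonic O.meetSemilattice (sym p) (sym q))

  𝟎≤ : ∀ x → 𝟎 ≤ x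
  𝟎≤ x = subst (𝟎 ≤_) (proj₁ ∨-identity x) (x≤x∨y 𝟎 x)

  ≤𝟏 : ∀ x → x ≤ 𝟏
  ≤𝟏 = proj₂ ∧-identity

  x-x≡𝟎 : ∀ x → x - x ≡ 𝟎
  x-x≡𝟎 x = ≤-antisym (minus-least x x 𝟎 (x≤x∨y x 𝟎)) (𝟎≤ _)

  𝟏∨x≡𝟏 : ∀ x → 𝟏 ∨ x ≡ 𝟏
  𝟏∨x≡𝟏 x = ≤-antisym (≤𝟏 _) (x≤x∨y 𝟏 x)

  𝟏≡x∨[𝟏-x] : ∀ x → 𝟏 ≡ x ∨ (𝟏 - x)
  𝟏≡x∨[𝟏-x] x = ≤-antisym (minus-cover 𝟏 x) (≤𝟏 _)

  joinIrreducible-𝟏⇒topDichotomy : JoinIrreducible 𝟏 → TopDichotomy L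
  joinIrreducible-𝟏⇒topDichotomy ji z
    with ji (z ∷ 𝟏 - z ∷ []) (trans (𝟏≡x∨[𝟏-x] z) (cong (z ∨_) (sym (proj₂ ∨-identity _))))
  ... | here 𝟏≡z = inj₁ (sym 𝟏≡z)
  ... | there (here 𝟏≡𝟏-z) = inj₂ (sym 𝟏≡𝟏-z)

  topDichotomy⇒InV₂ : TopDichotomy L → InV₂ L
  topDichotomy⇒InV₂ dichotomy z with dichotomy z
  ... | inj₁ refl = trans (cong (_∧ (𝟏 - (𝟏 - 𝟏))) (x-x≡𝟎 𝟏)) (𝟎≤ _)
  ... | inj₂ 𝟏-z≡𝟏 = begin
    (𝟏 - z) ∧ (𝟏 - (𝟏 - z)) ≡⟨ cong₂ (λ u v → u ∧ (𝟏 - v)) 𝟏-z≡𝟏 𝟏-z≡𝟏 ⟩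
    𝟏 ∧ (𝟏 - 𝟏)             ≡⟨ cong (𝟏 ∧_) (x-x≡𝟎 𝟏) ⟩
    𝟏 ∧ 𝟎                   ≡⟨ proj₁ ∧-identity 𝟎 ⟩
    𝟎                       ∎
    where open ≡-Reasoning

module Extension (L : CoHeyting) (a c : CoHeyting.Carrier L) where
  open CoHeyting L
  open Properties L

  record Element : Set where
    constructor ⟨_,_⟩[_,_,_]
    field
      lo hi : Carrier
      lo≤hi : lo ≤ hi
      hi≤lo∨a : hi ≤ (lo ∨ a)
      hi∧c≤lo : (hi ∧ c) ≤ lo
  open Element

  Element-≡ : ∀ {d e : Element} → lo d ≡ lo e → hi d ≡ hi e → d ≡ e
  Element-≡ {⟨ _ , _ ⟩[ p , q , r ]} {⟨ _ , _ ⟩[ p′ , q′ , r′ ]} refl refl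
    rewrite uip p p′ | uip q q′ | uip r r′ = refl

  diagonal : Carrier → Element
  diagonal z = ⟨ z , z ⟩[ ≤-refl , x≤x∨y z a , x∧y≤x z c ]

  𝟎ᴱ 𝟏ᴱ : Element
  𝟎ᴱ = diagonal 𝟎
  𝟏ᴱ = diagonal 𝟏

  _∨ᴱ_ : Element → Element → Element
  ⟨ x₁ , y₁ ⟩[ p₁ , q₁ , r₁ ] ∨ᴱ ⟨ x₂ , y₂ ⟩[ p₂ , q₂ , r₂ ] =
    ⟨ x₁ ∨ x₂ , y₁ ∨ y₂ ⟩[ ∨-monotonic p₁ p₂
                        , ∨-least (≤-trans q₁ (∨-monotonic (x≤x∨y x₁ x₂) ≤-refl))
                                  (≤-trans q₂ (∨-monotonic (y≤x∨y x₁ x₂) ≤-refl))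
                        , subst (_≤ (x₁ ∨ x₂)) (sym (∧-distribʳ-∨ c y₁ y₂)) (∨-monotonic r₁ r₂) ]

  _∧ᴱ_ : Element → Element → Element
  ⟨ x₁ , y₁ ⟩[ p₁ , q₁ , r₁ ] ∧ᴱ ⟨ x₂ , y₂ ⟩[ p₂ , q₂ , r₂ ] =
    ⟨ x₁ ∧ x₂ , y₁ ∧ y₂ ⟩[ ∧-monotonic p₁ p₂
                        , subst ((y₁ ∧ y₂) ≤_) (sym (∨-distribʳ-∧ a x₁ x₂)) (∧-monotonic q₁ q₂)
                        , ∧-greatest (≤-trans (∧-monotonic (x∧y≤x y₁ y₂) ≤-refl) r₁)
                                     (≤-trans (∧-monotonic (x∧y≤y y₁ y₂) ≤-refl) r₂) ]

  -- Componentwise, except that the lower part is enlarged by (y₁ - y₂) ∧ c to restore hi ∧ c ≤ lo.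
  _-ᴱ_ : Element → Element → Element
  ⟨ x₁ , y₁ ⟩[ p₁ , q₁ , r₁ ] -ᴱ ⟨ x₂ , y₂ ⟩[ p₂ , q₂ , r₂ ] =
    ⟨ u , (x₁ - x₂) ∨ (y₁ - y₂) ⟩[ ∨-monotonic ≤-refl (x∧y≤x _ c)
                                 , ∨-least (≤-trans (x≤x∨y _ _) (x≤x∨y u a))
                                           (≤-trans (minus-least y₁ y₂ _ y₁≤y₂∨[x₁-x₂]∨a)
                                                    (∨-monotonic (x≤x∨y _ _) ≤-refl))
                                 , subst (_≤ u) (sym (∧-distribʳ-∨ c (x₁ - x₂) (y₁ - y₂)))
                                         (∨-monotonic (x∧y≤x _ c) ≤-refl) ]
    where
    u : Carrier
    u = (x₁ - x₂) ∨ ((y₁ - y₂) ∧ c)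
    y₁≤y₂∨[x₁-x₂]∨a : y₁ ≤ (y₂ ∨ ((x₁ - x₂) ∨ a))
    y₁≤y₂∨[x₁-x₂]∨a = ≤-trans q₁ (≤-trans (∨-monotonic (minus-cover x₁ x₂) ≤-refl)
                        (subst (_≤ (y₂ ∨ ((x₁ - x₂) ∨ a))) (sym (∨-assoc x₂ (x₁ - x₂) a))
                               (∨-monotonic p₂ ≤-refl)))

  isDistributiveLatticeᴱ : IsDistributiveLattice (_≡_ {A = Element}) _∨ᴱ_ _∧ᴱ_
  isDistributiveLatticeᴱ = record
    { isLattice = record
      { isEquivalence = isEquivalence
      ; ∨-comm        = λ _ _ → Element-≡ (∨-comm _ _) (∨-comm _ _)
      ; ∨-assoc       = λ _ _ _ → Element-≡ (∨-assoc _ _ _) (∨-assoc _ _ _)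
      ; ∨-cong        = cong₂ _∨ᴱ_
      ; ∧-comm        = λ _ _ → Element-≡ (∧-comm _ _) (∧-comm _ _)
      ; ∧-assoc       = λ _ _ _ → Element-≡ (∧-assoc _ _ _) (∧-assoc _ _ _)
      ; ∧-cong        = cong₂ _∧ᴱ_
      ; absorptive    = (λ _ _ → Element-≡ (∨-absorbs-∧ _ _) (∨-absorbs-∧ _ _))
                      , (λ _ _ → Element-≡ (∧-absorbs-∨ _ _) (∧-absorbs-∨ _ _))
      }
    ; ∨-distrib-∧ = (λ _ _ _ → Element-≡ (∨-distribˡ-∧ _ _ _) (∨-distribˡ-∧ _ _ _))
                  , (λ _ _ _ → Element-≡ (∨-distribʳ-∧ _ _ _) (∨-distribʳ-∧ _ _ _))
    ; ∧-distrib-∨ = (λ _ _ _ → Element-≡ (∧-distribˡ-∨ _ _ _) (∧-distribˡ-∨ _ _ _))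
                  , (λ _ _ _ → Element-≡ (∧-distribʳ-∨ _ _ _) (∧-distribʳ-∨ _ _ _))
    }

  extension : CoHeyting
  extension = record
    { Carrier               = Element
    ; 𝟎                     = 𝟎ᴱ
    ; 𝟏                     = 𝟏ᴱ
    ; _∨_                   = _∨ᴱ_
    ; _∧_                   = _∧ᴱ_
    ; _-_                   = _-ᴱ_
    ; isDistributiveLattice = isDistributiveLatticeᴱ
    ; ∨-identity            = (λ _ → Element-≡ (proj₁ ∨-identity _) (proj₁ ∨-identity _))
                            , (λ _ → Element-≡ (proj₂ ∨-identity _) (proj₂ ∨-identity _))
    ; ∧-identity            = (λ _ → Element-≡ (proj₁ ∧-identity _) (proj₁ ∧-identity _))
                            , (λ _ → Element-≡ (proj₂ ∧-identity _) (proj₂ ∧-identity _))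
    ; minus-cover           = λ d e → Element-≡
        (≤-trans (minus-cover (lo d) (lo e)) (∨-monotonic ≤-refl (x≤x∨y _ _)))
        (≤-trans (minus-cover (hi d) (hi e)) (∨-monotonic ≤-refl (y≤x∨y _ _)))
    ; minus-least           = λ d e g d≤e∨g →
        let lo-d-e≤lo-g = minus-least (lo d) (lo e) (lo g) (cong lo d≤e∨g)
            hi-d-e≤hi-g = minus-least (hi d) (hi e) (hi g) (cong hi d≤e∨g)
        in Element-≡ (∨-least lo-d-e≤lo-g (≤-trans (∧-monotonic hi-d-e≤hi-g ≤-refl) (hi∧c≤lo g)))
                     (∨-least (≤-trans lo-d-e≤lo-g (lo≤hi g)) hi-d-e≤hi-g)
    }

  diagonal-embedding : Embedding L extension
  diagonal-embedding = record
    { f         = diagonal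
    ; injective = cong lo
    ; pres-𝟎    = refl
    ; pres-𝟏    = refl
    ; pres-∨    = λ _ _ → Element-≡ refl refl
    ; pres-∧    = λ _ _ → Element-≡ refl refl
    ; pres--    = λ _ _ → Element-≡ (sym (∨-absorbs-∧ _ _)) (sym (∨-idem _))
    }

  lo≡𝟏⇒≡𝟏ᴱ : ∀ d → lo d ≡ 𝟏 → d ≡ 𝟏ᴱ
  lo≡𝟏⇒≡𝟏ᴱ d lo≡𝟏 = Element-≡ lo≡𝟏 (≤-antisym (≤𝟏 _) (subst (_≤ hi d) lo≡𝟏 (lo≤hi d)))

  extension-topDichotomy : TopDichotomy L → TopDichotomy extension
  extension-topDichotomy dichotomy d with dichotomy (lo d)
  ... | inj₁ lo≡𝟏 = inj₁ (lo≡𝟏⇒≡𝟏ᴱ d lo≡𝟏)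
  ... | inj₂ 𝟏-lo≡𝟏 = inj₂ (lo≡𝟏⇒≡𝟏ᴱ (𝟏ᴱ -ᴱ d) (trans (cong (_∨ ((𝟏 - hi d) ∧ c)) 𝟏-lo≡𝟏) (𝟏∨x≡𝟏 _)))

  middle : c ≤ a → Element
  middle c≤a = ⟨ c , a ⟩[ c≤a , y≤x∨y c a , x∧y≤y a c ]

  module _ (c≪a : c ≪ a) where
    open CoHeyting extension using () renaming (_≪_ to _≪ᴱ_)
    private
      a-c≡a : a - c ≡ a
      a-c≡a = proj₁ c≪a
      c≤a : c ≤ a
      c≤a = proj₂ c≪a
      a∧c≡c : a ∧ c ≡ c
      a∧c≡c = trans (∧-comm a c) c≤a

    diagonal-c≪middle : diagonal c ≪ᴱ middle c≤a
    diagonal-c≪middle =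
      Element-≡ (trans (cong₂ (λ u v → u ∨ (v ∧ c)) (x-x≡𝟎 c) a-c≡a)
                       (trans (proj₁ ∨-identity _) a∧c≡c))
                (trans (cong₂ _∨_ (x-x≡𝟎 c) a-c≡a) (proj₁ ∨-identity a))
      , Element-≡ (∧-idem c) c≤a

    middle≪diagonal-a : middle c≤a ≪ᴱ diagonal a
    middle≪diagonal-a =
      Element-≡ (trans (cong₂ (λ u v → u ∨ (v ∧ c)) a-c≡a (x-x≡𝟎 a))
                       (trans (cong (a ∨_) (𝟎≤ c)) (proj₂ ∨-identity a)))
                (trans (cong₂ _∨_ a-c≡a (x-x≡𝟎 a)) (proj₂ ∨-identity a))
      , Element-≡ c≤a (∧-idem a)

open CoHeyting
open Embedding

lemma5p2 : (L : CoHeyting) → Finite L → InV₂ L → JoinIrreducible L (𝟏 L) →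
    (a c : Carrier L) → _≪_ L c a →
    (Σ CoHeyting λ L' → InV₂ L' × Σ (Embedding L L') λ e → Σ (Carrier L') λ b →
        _≪_ L' (f e c) b × _≪_ L' b (f e a))
    × (¬ (a ≡ 𝟎 L) →
       Σ CoHeyting λ L' → InV₂ L' × Σ (Embedding L L') λ e → Σ (Carrier L') λ b →
        _≪_ L' (f e c) b × _≪_ L' b (f e a) × ¬ (b ≡ 𝟎 L'))
lemma5p2 L _ _ 𝟏-irreducible a c c≪a =
    (extension , extension-InV₂ , diagonal-embedding , b , diagonal-c≪middle c≪a , middle≪diagonal-a c≪a)
  , λ a≢𝟎 → extension , extension-InV₂ , diagonal-embedding , b
           , diagonal-c≪middle c≪a , middle≪diagonal-a c≪a , λ b≡𝟎 → a≢𝟎 (cong Element.hi b≡𝟎)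
  where
  open Extension L a c
  extension-InV₂ : InV₂ extension
  extension-InV₂ = Properties.topDichotomy⇒InV₂ extension
    (extension-topDichotomy (Properties.joinIrreducible-𝟏⇒topDichotomy L 𝟏-irreducible))
  b : Element
  b = middle (proj₂ c≪a)
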